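{- Let $\tau$ be a pattern, regarded as a subword (consecutive) pattern, whose largest letter is $r-1$, and let $\tau'=\tau\text{ - }r$. Then for all $k\ge r-1$, $$W_{\tau'}(x;k)=\frac{1}{(1-(r-1)x)\prod_{j=r-1}^{k-1}\bigl(1-xW_{\tau}(x;j)\bigr)}.$$
   Context: For $k\ge1$ let $[k]=\{1,\dots,k\}$; a $k$-ary word of length $n$ is an element of $[k]^n$ ($[0]^n$ is empty for $n\ge1$, and the empty word is the unique word of length $0$). A pattern is a word in $[p]^m$ in which each letter of $[p]$ occurs. Two words are order-isomorphic if replacing the $i$-th smallest distinct letter by $i$ yields the same word. A word $w$ contains the subword pattern $\tau$ of length $m$ if some $m$ consecutive letters of $w$ are order-isomorphic to $\tau$. For $\tau$ of length $m$, the vincular pattern $\tau\text{ - }r$ occurs in $w=w_1\cdots w_n$ if there are indices $p$ and $q\ge p+m$ with $w_p\cdots w_{p+m-1}w_q$ order-isomorphic to the word $\tau r$. $a_\sigma(n,k)$ denotes the number of words in $[k]^n$ avoiding $\sigma$, and $W_\sigma(x;k)=\sum_{n\ge0}a_\sigma(n,k)x^n$ (formal power series). An empty product equals $1$. -}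

module Defs where

open import Data.Nat using (ℕ; zero; suc; _+_; _∸_; _≤ᵇ_; _≟_)
open import Data.Bool using (Bool; true; false; _∧_; if_then_else_)
open import Data.List using (List; []; _∷_; [_]; map; length; filter; upTo; take; drop;
  concatMap; foldr; _++_; applyUpTo)
open import Data.Bool.ListAction using (any)
open import Data.Bool using (not; T?)
open import Data.Product using (_×_)
open import Data.List.Relation.Unary.All using (All)
open import Data.List.Membership.Propositional using (_∈_)
open import Data.Nat using (_≤_; _<_)
open import Data.List.Membership.DecPropositional _≟_ using (_∈?_)
import Data.List.Properties as LP
open import Data.Integer using (ℤ; +_; _*_; _-_)
import Data.Integer as ℤ
open import Relation.Nullary.Decidable using (⌊_⌋)

-- Words are lists of natural numbers; a k-ary word has letters in {1,…,k}.
Word : Set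
Word = List ℕ

words : ℕ → ℕ → List Word
words zero    k = [] ∷ []
words (suc n) k = concatMap (λ a → map (a ∷_) (words n k)) (applyUpTo suc k)

rank : Word → ℕ → ℕ
rank w a = length (filter (λ b → b ∈? w) (upTo a))

std : Word → Word
std w = map (λ a → suc (rank w a)) w

_=ʷ_ : Word → Word → Bool
u =ʷ v = ⌊ LP.≡-dec _≟_ u v ⌋

orderIso : Word → Word → Bool
orderIso u v = std u =ʷ std v

-- nth letter (0-indexed), defaulting to 0 outside range (only used in range)
at : Word → ℕ → ℕ
at []       _       = 0
at (x ∷ _)  zero    = x
at (_ ∷ xs) (suc i) = at xs i

factor : Word → ℕ → ℕ → Word
factor w p m = take m (drop p w)

containsSub : Word → Word → Bool
containsSub τ w =
  any (λ p → ((p + length τ) ≤ᵇ length w) ∧ orderIso (factor w p (length τ)) τ)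
      (upTo (suc (length w)))

-- w contains the vincular pattern τ-r : indices p, q (0-indexed) with
-- q ≥ p + |τ|, q < |w|, and w_p…w_{p+m-1} w_q order-isomorphic to τ r
containsVinc : Word → ℕ → Word → Bool
containsVinc τ r w =
  any (λ p → any (λ q →
        ((p + length τ) ≤ᵇ q) ∧ (suc q ≤ᵇ length w)
        ∧ orderIso (factor w p (length τ) ++ [ at w q ]) (τ ++ [ r ]))
      (upTo (length w)))
    (upTo (length w))

count : (Word → Bool) → List Word → ℕ
count P ws = length (filter (λ w → T? (P w)) ws)

avoiders : (Word → Bool) → ℕ → ℕ → ℕ
avoiders contains n k = count (λ w → not (contains w)) (words n k)

aSub : Word → ℕ → ℕ → ℕ
aSub τ n k = avoiders (containsSub τ) n k

aVinc : Word → ℕ → ℕ → ℕ → ℕ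
aVinc τ r n k = avoiders (containsVinc τ r) n k

PS : Set
PS = ℕ → ℤ

one : PS
one zero    = + 1
one (suc _) = + 0

xMul : PS → PS
xMul f zero    = + 0
xMul f (suc n) = f n

_⊛_ : PS → PS → PS
(f ⊛ g) n = foldr ℤ._+_ (+ 0) (map (λ i → f i * g (n ∸ i)) (upTo (suc n)))

_⊖_ : PS → PS → PS
(f ⊖ g) n = f n - g n

constPS : ℤ → PS
constPS c zero    = c
constPS c (suc _) = + 0

prodRange : ℕ → ℕ → (ℕ → PS) → PS
prodRange a b F = foldr (λ j acc → F j ⊛ acc) one (map (λ i → a + i) (upTo (b ∸ a)))

WSub : Word → ℕ → PS
WSub τ k n = + aSub τ n k

WVinc : Word → ℕ → ℕ → PS
WVinc τ r k n = + aVinc τ r n k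

IsPatternMax : Word → ℕ → Set
IsPatternMax τ r =
  (2 ≤ r)
  × All (λ a → (1 ≤ a) × (a < r)) τ
  × (∀ j → 1 ≤ j → j < r → j ∈ τ)

module Submission where

-- Split a word over [k+1] at the first occurrence of its largest letter: w = u (k+1) v with u over [k].
-- The letter playing r in τ-r exceeds the whole copy of τ before it, so w avoids τ-r iff u avoids τ and
-- v avoids τ-r. Hence W_τ'(x;k+1) = W_τ'(x;k) + x W_τ(x;k) W_τ'(x;k+1), that is
-- (1 - x W_τ(x;k)) W_τ'(x;k+1) = W_τ'(x;k), and the product over k telescopes. It starts at k = r-1:
-- no letter of [r-1] exceeds r-1 distinct smaller positive letters, so every word over [r-1] avoids τ-r
-- and W_τ'(x;r-1) = 1/(1-(r-1)x).

open import Defs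
open import Data.Nat using (ℕ; suc; _≤_; _∸_)
open import Data.Integer using (+_)
open import Relation.Binary.PropositionalEquality using (_≡_; _≗_)
open import Algebra.Bundles using (CommutativeSemiring; CommutativeMonoid)
import Data.Nat.Properties as ℕ
import Data.Integer.Properties as ℤ

module FiniteSums {c ℓ} (R : CommutativeSemiring c ℓ) where

  open import Data.Nat using (zero; _<_; s≤s; z≤n)
  open import Function using (_∘_)
  open CommutativeSemiring R
  open import Relation.Binary.Reasoning.Setoid setoid
  open import Algebra.Properties.CommutativeSemigroup +-commutativeSemigroup using (interchange)

  ∑< : (ℕ → Carrier) → ℕ → Carrier
  ∑< h zero    = 0#
  ∑< h (suc n) = h 0 + ∑< (h ∘ suc) n

  ∑<-cong : ∀ {h h′} n → (∀ i → i < n → h i ≈ h′ i) → ∑< h n ≈ ∑< h′ n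
  ∑<-cong zero    h≈h′ = refl
  ∑<-cong (suc n) h≈h′ = +-cong (h≈h′ 0 (s≤s z≤n)) (∑<-cong n (λ i i<n → h≈h′ (suc i) (s≤s i<n)))

  ∑<-zero : ∀ {h} n → (∀ i → h i ≈ 0#) → ∑< h n ≈ 0#
  ∑<-zero zero    h≈0 = refl
  ∑<-zero (suc n) h≈0 = trans (+-cong (h≈0 0) (∑<-zero n (h≈0 ∘ suc))) (+-identityˡ 0#)

  ∑<-suc : ∀ h n → ∑< h (suc n) ≈ ∑< h n + h n
  ∑<-suc h zero    = +-comm (h 0) 0#
  ∑<-suc h (suc n) = begin
    h 0 + ∑< (h ∘ suc) (suc n)       ≈⟨ +-congˡ (∑<-suc (h ∘ suc) n) ⟩
    h 0 + (∑< (h ∘ suc) n + h (suc n)) ≈⟨ sym (+-assoc _ _ _) ⟩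
    h 0 + ∑< (h ∘ suc) n + h (suc n)   ∎

  ∑<-+ : ∀ f g n → ∑< (λ i → f i + g i) n ≈ ∑< f n + ∑< g n
  ∑<-+ f g zero    = sym (+-identityˡ 0#)
  ∑<-+ f g (suc n) = trans (+-congˡ (∑<-+ (f ∘ suc) (g ∘ suc) n)) (interchange _ _ _ _)

  ∑<-*ˡ : ∀ x h n → ∑< (λ i → x * h i) n ≈ x * ∑< h n
  ∑<-*ˡ x h zero    = sym (zeroʳ x)
  ∑<-*ˡ x h (suc n) = trans (+-congˡ (∑<-*ˡ x (h ∘ suc) n)) (sym (distribˡ x _ _))

  ∑<-*ʳ : ∀ x h n → ∑< (λ i → h i * x) n ≈ ∑< h n * x
  ∑<-*ʳ x h zero    = sym (zeroˡ x)
  ∑<-*ʳ x h (suc n) = trans (+-congˡ (∑<-*ʳ x (h ∘ suc) n)) (sym (distribʳ x _ _))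

  ∑<-comm : ∀ (g : ℕ → ℕ → Carrier) m n → ∑< (λ a → ∑< (g a) m) n ≈ ∑< (λ i → ∑< (λ a → g a i) n) m
  ∑<-comm g m zero    = sym (∑<-zero m (λ _ → refl))
  ∑<-comm g m (suc n) = begin
    ∑< (g 0) m + ∑< (λ a → ∑< (g (suc a)) m) n                ≈⟨ +-congˡ (∑<-comm (g ∘ suc) m n) ⟩
    ∑< (g 0) m + ∑< (λ i → ∑< (λ a → g (suc a) i) n) m        ≈⟨ sym (∑<-+ _ _ m) ⟩
    ∑< (λ i → g 0 i + ∑< (λ a → g (suc a) i) n) m            ∎

module ℕ-Sums = FiniteSums ℕ.+-*-commutativeSemiring
module ℤ-Sums = FiniteSums ℤ.+-*-commutativeSemiring

module PowerSeries where

  open import Algebra.Structures using (IsCommutativeMonoid)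
  open import Data.Nat as ℕ using (zero)
  open import Data.Integer using (ℤ; _+_; _*_; _-_; -1ℤ)
  open import Data.Integer.Tactic.RingSolver using (solve-∀)
  open import Data.List using (_∷_; foldr; map; applyUpTo; upTo)
  import Data.List.Properties as List
  open import Data.Product using (_,_)
  open import Function using (_∘_; id)
  open import Relation.Binary.PropositionalEquality
  open ℤ-Sums

  conv : PS → PS → PS
  conv f g n = ∑< (λ i → f i * g (n ∸ i)) (suc n)

  foldr-map-applyUpTo : ∀ (h : ℕ → ℤ) g n → foldr _+_ (+ 0) (map h (applyUpTo g n)) ≡ ∑< (h ∘ g) n
  foldr-map-applyUpTo h g zero    = refl
  foldr-map-applyUpTo h g (suc n) = cong (_+_ (h (g 0))) (foldr-map-applyUpTo h (g ∘ suc) n)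

  ⊛≗conv : ∀ f g → f ⊛ g ≗ conv f g
  ⊛≗conv f g n = foldr-map-applyUpTo (λ i → f i * g (n ∸ i)) id (suc n)

  conv-suc : ∀ f g n → conv f g (suc n) ≡ conv f (g ∘ suc) n + f (suc n) * g 0
  conv-suc f g n = trans (∑<-suc (λ i → f i * g (suc n ∸ i)) (suc n))
    (cong₂ _+_ (∑<-cong (suc n) (λ i i≤n → cong (λ m → f i * g m) (ℕ.+-∸-assoc 1 (ℕ.≤-pred i≤n))))
               (cong (λ m → f (suc n) * g m) (ℕ.n∸n≡0 n)))

  conv-comm : ∀ f g → conv f g ≗ conv g f
  conv-comm f g zero    = cong (_+ + 0) (ℤ.*-comm (f 0) (g 0))
  conv-comm f g (suc n) = begin
    f 0 * g (suc n) + conv (f ∘ suc) g n   ≡⟨ cong (_+_ (f 0 * g (suc n))) (conv-comm (f ∘ suc) g n) ⟩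
    f 0 * g (suc n) + conv g (f ∘ suc) n   ≡⟨ swap (f 0) (g (suc n)) _ ⟩
    conv g (f ∘ suc) n + g (suc n) * f 0   ≡⟨ sym (conv-suc g f n) ⟩
    conv g f (suc n)                       ∎
    where
    open ≡-Reasoning
    swap : ∀ a b c → a * b + c ≡ c + b * a
    swap = solve-∀

  conv-congˡ : ∀ {f f′} g → f ≗ f′ → conv f g ≗ conv f′ g
  conv-congˡ g f≗f′ n = ∑<-cong (suc n) (λ i _ → cong (_* g (n ∸ i)) (f≗f′ i))

  conv-congʳ : ∀ f {g g′} → g ≗ g′ → conv f g ≗ conv f g′
  conv-congʳ f g≗g′ n = ∑<-cong (suc n) (λ i _ → cong (f i *_) (g≗g′ (n ∸ i)))

  conv-+ˡ : ∀ f f′ g → conv (λ i → f i + f′ i) g ≗ λ n → conv f g n + conv f′ g n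
  conv-+ˡ f f′ g n = trans (∑<-cong (suc n) (λ i _ → ℤ.*-distribʳ-+ (g (n ∸ i)) (f i) (f′ i)))
    (∑<-+ (λ i → f i * g (n ∸ i)) (λ i → f′ i * g (n ∸ i)) (suc n))

  conv-*ˡ : ∀ c f g → conv (λ i → c * f i) g ≗ λ n → c * conv f g n
  conv-*ˡ c f g n = trans (∑<-cong (suc n) (λ i _ → ℤ.*-assoc c (f i) (g (n ∸ i))))
    (∑<-*ˡ c (λ i → f i * g (n ∸ i)) (suc n))

  conv-assoc : ∀ f g h → conv (conv f g) h ≗ conv f (conv g h)
  conv-assoc f g h zero    = regroup (f 0) (g 0) (h 0)
    where
    regroup : ∀ a b c → (a * b + + 0) * c + + 0 ≡ a * (b * c + + 0) + + 0
    regroup = solve-∀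
  conv-assoc f g h (suc n) = begin
    conv f g 0 * h (suc n) + conv (λ i → f 0 * g (suc i) + conv (f ∘ suc) g i) h n
      ≡⟨ cong (_+_ (conv f g 0 * h (suc n))) (conv-+ˡ (λ i → f 0 * g (suc i)) (conv (f ∘ suc) g) h n) ⟩
    conv f g 0 * h (suc n) + (conv (λ i → f 0 * g (suc i)) h n + conv (conv (f ∘ suc) g) h n)
      ≡⟨ cong₂ (λ x y → conv f g 0 * h (suc n) + (x + y)) (conv-*ˡ (f 0) (g ∘ suc) h n) (conv-assoc (f ∘ suc) g h n) ⟩
    conv f g 0 * h (suc n) + (f 0 * conv (g ∘ suc) h n + conv (f ∘ suc) (conv g h) n)
      ≡⟨ regroup (f 0) (g 0) (h (suc n)) (conv (g ∘ suc) h n) (conv (f ∘ suc) (conv g h) n) ⟩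
    f 0 * conv g h (suc n) + conv (f ∘ suc) (conv g h) n
      ∎
    where
    open ≡-Reasoning
    regroup : ∀ a b c x y → (a * b + + 0) * c + (a * x + y) ≡ a * (b * c + x) + y
    regroup = solve-∀

  conv-identityˡ : ∀ f → conv one f ≗ f
  conv-identityˡ f zero    = trans (ℤ.+-identityʳ _) (ℤ.*-identityˡ (f 0))
  conv-identityˡ f (suc n) = trans (cong₂ _+_ (ℤ.*-identityˡ (f (suc n))) (∑<-zero (suc n) (λ i → ℤ.*-zeroˡ (f (n ∸ i)))))
    (ℤ.+-identityʳ _)

  ⊛-isCommutativeMonoid : IsCommutativeMonoid _≗_ _⊛_ one
  ⊛-isCommutativeMonoid = record
    { isMonoid = record
      { isSemigroup = record
        { isMagma = record
          { isEquivalence = record { refl = λ _ → refl ; sym = λ e n → sym (e n) ; trans = λ e e′ n → trans (e n) (e′ n) }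
          ; ∙-cong = λ {f} {f′} {g} {g′} f≗f′ g≗g′ n → begin
              (f ⊛ g) n     ≡⟨ ⊛≗conv f g n ⟩
              conv f g n    ≡⟨ conv-congˡ g f≗f′ n ⟩
              conv f′ g n   ≡⟨ conv-congʳ f′ g≗g′ n ⟩
              conv f′ g′ n  ≡⟨ ⊛≗conv f′ g′ n ⟨
              (f′ ⊛ g′) n   ∎
          }
        ; assoc = λ f g h n → begin
            ((f ⊛ g) ⊛ h) n          ≡⟨ ⊛≗conv (f ⊛ g) h n ⟩
            conv (f ⊛ g) h n         ≡⟨ conv-congˡ h (⊛≗conv f g) n ⟩
            conv (conv f g) h n      ≡⟨ conv-assoc f g h n ⟩
            conv f (conv g h) n      ≡⟨ conv-congʳ f (⊛≗conv g h) n ⟨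
            conv f (g ⊛ h) n         ≡⟨ ⊛≗conv f (g ⊛ h) n ⟨
            (f ⊛ (g ⊛ h)) n          ∎
        }
      ; identity = identityˡ , λ f n → trans (comm f one n) (identityˡ f n)
      }
    ; comm = comm
    }
    where
    open ≡-Reasoning
    comm : ∀ f g → f ⊛ g ≗ g ⊛ f
    comm f g n = trans (⊛≗conv f g n) (trans (conv-comm f g n) (sym (⊛≗conv g f n)))
    identityˡ : ∀ f → one ⊛ f ≗ f
    identityˡ f n = trans (⊛≗conv one f n) (conv-identityˡ f n)

  ⊛-commutativeMonoid : CommutativeMonoid _ _
  ⊛-commutativeMonoid = record { isCommutativeMonoid = ⊛-isCommutativeMonoid }

  open CommutativeMonoid ⊛-commutativeMonoid using (∙-congˡ; identityʳ)
  open import Algebra.Properties.CommutativeSemigroup (CommutativeMonoid.commutativeSemigroup ⊛-commutativeMonoid)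
    using (x∙yz≈y∙xz)

  one⊖xMul-⊛-recurrence : ∀ W V V′ → (∀ n → V n ≡ V′ n + xMul (W ⊛ V) n) → (one ⊖ xMul W) ⊛ V ≗ V′
  one⊖xMul-⊛-recurrence W V V′ V≡ zero =
    trans (⊛≗conv (one ⊖ xMul W) V 0) (trans (cong (λ v → (+ 1 - + 0) * v + + 0) (V≡ 0)) (simplify (V′ 0)))
    where
    simplify : ∀ v → (+ 1 - + 0) * (v + + 0) + + 0 ≡ v
    simplify = solve-∀
  one⊖xMul-⊛-recurrence W V V′ V≡ (suc n) = begin
    ((one ⊖ xMul W) ⊛ V) (suc n)
      ≡⟨ ⊛≗conv (one ⊖ xMul W) V (suc n) ⟩
    (+ 1 - + 0) * V (suc n) + conv (λ i → + 0 - W i) V n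
      ≡⟨ cong (_+_ ((+ 1 - + 0) * V (suc n))) (conv-congˡ V (λ i → negate (W i)) n) ⟩
    (+ 1 - + 0) * V (suc n) + conv (λ i → -1ℤ * W i) V n
      ≡⟨ cong (_+_ ((+ 1 - + 0) * V (suc n))) (conv-*ˡ -1ℤ W V n) ⟩
    (+ 1 - + 0) * V (suc n) + -1ℤ * conv W V n
      ≡⟨ cong₂ (λ v c → (+ 1 - + 0) * v + -1ℤ * c) (sym (V≡ (suc n))) (⊛≗conv W V n) ⟨
    (+ 1 - + 0) * (V′ (suc n) + (W ⊛ V) n) + -1ℤ * (W ⊛ V) n
      ≡⟨ cancel (V′ (suc n)) ((W ⊛ V) n) ⟩
    V′ (suc n)
      ∎
    where
    open ≡-Reasoning
    negate : ∀ w → + 0 - w ≡ -1ℤ * w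
    negate = solve-∀
    cancel : ∀ v c → (+ 1 - + 0) * (v + c) + -1ℤ * c ≡ v
    cancel = solve-∀

  constPS-⊛ : ∀ c V → constPS c ⊛ V ≗ λ n → c * V n
  constPS-⊛ c V n = trans (⊛≗conv (constPS c) V n)
    (trans (cong (_+_ (c * V n)) (∑<-zero n (λ i → ℤ.*-zeroˡ (V (n ∸ suc i))))) (ℤ.+-identityʳ (c * V n)))

  one⊖xMul-const-⊛-powers : ∀ a V → (∀ n → V n ≡ + (a ℕ.^ n)) → (one ⊖ xMul (constPS (+ a))) ⊛ V ≗ one
  one⊖xMul-const-⊛-powers a V V≡ = one⊖xMul-⊛-recurrence (constPS (+ a)) V one recurrence
    where
    recurrence : ∀ n → V n ≡ one n + xMul (constPS (+ a) ⊛ V) n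
    recurrence zero    = V≡ 0
    recurrence (suc n) = begin
      V (suc n)                      ≡⟨ V≡ (suc n) ⟩
      + (a ℕ.* a ℕ.^ n)              ≡⟨ ℤ.pos-* a (a ℕ.^ n) ⟩
      + a * + (a ℕ.^ n)              ≡⟨ cong (+ a *_) (V≡ n) ⟨
      + a * V n                      ≡⟨ constPS-⊛ (+ a) V n ⟨
      (constPS (+ a) ⊛ V) n          ≡⟨ ℤ.+-identityˡ _ ⟨
      + 0 + (constPS (+ a) ⊛ V) n    ∎
      where open ≡-Reasoning

  prodRange-empty : ∀ {a b} F → b ≤ a → prodRange a b F ≡ one
  prodRange-empty {a} {b} F b≤a =
    cong (λ d → foldr (λ j acc → F j ⊛ acc) one (map (a ℕ.+_) (upTo d))) (ℕ.m≤n⇒m∸n≡0 b≤a)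

  prodRange-split : ∀ {a b} F → a ℕ.< b → prodRange a b F ≡ F a ⊛ prodRange (suc a) b F
  prodRange-split {a} {b} F a<b = cong (foldr (λ j acc → F j ⊛ acc) one) (begin
    map (a ℕ.+_) (upTo (b ∸ a))                     ≡⟨ cong (map (a ℕ.+_) ∘ upTo) (ℕ.+-∸-assoc 1 a<b) ⟩
    a ℕ.+ 0 ∷ map (a ℕ.+_) (applyUpTo suc d)         ≡⟨ cong₂ _∷_ (ℕ.+-identityʳ a) (List.map-applyUpTo suc (a ℕ.+_) d) ⟩
    a ∷ applyUpTo (λ i → a ℕ.+ suc i) d             ≡⟨ cong (a ∷_) (List.map-upTo (λ i → a ℕ.+ suc i) d) ⟨
    a ∷ map (λ i → a ℕ.+ suc i) (upTo d)            ≡⟨ cong (a ∷_) (List.map-cong (ℕ.+-suc a) (upTo d)) ⟩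
    a ∷ map (suc a ℕ.+_) (upTo d)                   ∎)
    where
    open ≡-Reasoning
    d : ℕ
    d = b ∸ suc a

  prodRange-telescope : ∀ (V F : ℕ → PS) → (∀ j → F j ⊛ V (suc j) ≗ V j) →
                        ∀ {a b} → a ≤ b → V b ⊛ prodRange a b F ≗ V a
  prodRange-telescope V F step {a} a≤b with ℕ.m≤n⇒∃[o]m+o≡n a≤b
  ... | d , refl = from a d
    where
    from : ∀ a d → V (a ℕ.+ d) ⊛ prodRange a (a ℕ.+ d) F ≗ V a
    from a zero    rewrite ℕ.+-identityʳ a | prodRange-empty {a} F ℕ.≤-refl = identityʳ (V a)
    from a (suc d) rewrite ℕ.+-suc a d = begin
      V b′ ⊛ prodRange a b′ F                      ≡⟨ cong (V b′ ⊛_) (prodRange-split F (ℕ.s≤s (ℕ.m≤m+n a d))) ⟩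
      V b′ ⊛ (F a ⊛ prodRange (suc a) b′ F)        ≈⟨ x∙yz≈y∙xz (V b′) (F a) (prodRange (suc a) b′ F) ⟩
      F a ⊛ (V b′ ⊛ prodRange (suc a) b′ F)        ≈⟨ ∙-congˡ {F a} (from (suc a) d) ⟩
      F a ⊛ V (suc a)                              ≈⟨ step a ⟩
      V a                                          ∎
      where
      open import Relation.Binary.Reasoning.Setoid (CommutativeMonoid.setoid ⊛-commutativeMonoid)
      b′ : ℕ
      b′ = suc a ℕ.+ d

module Standardisation where

  open import Data.Nat as ℕ using (zero; _<_; s≤s; z≤n; _+_; _≟_)
  open import Data.List using (List; []; _∷_; map; upTo; _++_; [_]; filter; length)
  import Data.List.Properties as List
  open import Data.List.Membership.Propositional using (_∈_; _∉_)
  open import Data.List.Membership.Propositional.Properties using (∈-map⁺; ∈-map⁻; ∈-++⁺ˡ; ∈-++⁻)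
  open import Data.List.Membership.DecPropositional _≟_ using (_∈?_)
  open import Data.List.Relation.Unary.All as All using (All; []; _∷_)
  open import Data.List.Relation.Unary.Any using (here)
  open import Data.Bool using (T)
  open import Data.Product using (_×_; _,_; proj₁; proj₂; ∃)
  open import Data.Sum using (inj₁; inj₂; [_,_]′)
  open import Data.Empty using (⊥-elim)
  open import Function using (_∘_; _⇔_; mk⇔)
  open import Relation.Nullary using (¬_; yes; no)
  open import Relation.Nullary.Decidable using (toWitness; fromWitness)
  open import Relation.Binary.PropositionalEquality hiding ([_])
  open ≡-Reasoning

  rank-suc : ∀ w a → rank w (suc a) ≡ rank w a + length (filter (_∈? w) [ a ])
  rank-suc w a = begin
    length (filter (_∈? w) (upTo (suc a)))                     ≡⟨ cong (length ∘ filter (_∈? w)) (List.upTo-∷ʳ a) ⟨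
    length (filter (_∈? w) (upTo a ++ [ a ]))                  ≡⟨ cong length (List.filter-++ (_∈? w) (upTo a) [ a ]) ⟩
    length (filter (_∈? w) (upTo a) ++ filter (_∈? w) [ a ])   ≡⟨ List.length-++ (filter (_∈? w) (upTo a)) ⟩
    rank w a + length (filter (_∈? w) [ a ])                   ∎

  rank-suc-∈ : ∀ {w a} → a ∈ w → rank w (suc a) ≡ suc (rank w a)
  rank-suc-∈ {w} {a} a∈w = trans (rank-suc w a)
    (trans (cong (λ l → rank w a + length l) (List.filter-accept (_∈? w) a∈w)) (ℕ.+-comm (rank w a) 1))

  rank-suc-∉ : ∀ {w a} → a ∉ w → rank w (suc a) ≡ rank w a
  rank-suc-∉ {w} {a} a∉w = trans (rank-suc w a)
    (trans (cong (λ l → rank w a + length l) (List.filter-reject (_∈? w) a∉w)) (ℕ.+-identityʳ (rank w a)))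

  rank-≤-suc : ∀ w a → rank w a ≤ rank w (suc a)
  rank-≤-suc w a = ℕ.≤-trans (ℕ.m≤m+n (rank w a) _) (ℕ.≤-reflexive (sym (rank-suc w a)))

  rank-suc-≤ : ∀ w a → rank w (suc a) ≤ suc (rank w a)
  rank-suc-≤ w a = ℕ.≤-trans (ℕ.≤-reflexive (rank-suc w a))
    (ℕ.≤-trans (ℕ.+-monoʳ-≤ (rank w a) (List.length-filter (_∈? w) [ a ])) (ℕ.≤-reflexive (ℕ.+-comm (rank w a) 1)))

  rank-mono : ∀ w {a b} → a ≤ b → rank w a ≤ rank w b
  rank-mono w a≤b = mono′ (ℕ.≤⇒≤′ a≤b)
    where
    mono′ : ∀ {a b} → a ℕ.≤′ b → rank w a ≤ rank w b
    mono′ ℕ.≤′-refl        = ℕ.≤-refl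
    mono′ (ℕ.≤′-step a≤′b) = ℕ.≤-trans (mono′ a≤′b) (rank-≤-suc w _)

  rank-< : ∀ w {a b} → a ∈ w → a < b → rank w a < rank w b
  rank-< w {a} a∈w a<b = ℕ.≤-trans (ℕ.≤-reflexive (sym (rank-suc-∈ a∈w))) (rank-mono w a<b)

  rank-positive-≤ : ∀ w b → 0 ∉ w → rank w (suc b) ≤ b
  rank-positive-≤ w zero    0∉w = ℕ.≤-reflexive (rank-suc-∉ 0∉w)
  rank-positive-≤ w (suc b) 0∉w = ℕ.≤-trans (rank-suc-≤ w (suc b)) (s≤s (rank-positive-≤ w b 0∉w))

  rank-cong : ∀ w w′ a → (∀ {x} → x < a → x ∈ w → x ∈ w′) → (∀ {x} → x < a → x ∈ w′ → x ∈ w) →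
              rank w a ≡ rank w′ a
  rank-cong w w′ zero    _  _  = refl
  rank-cong w w′ (suc a) to from with a ∈? w
  ... | yes a∈w = trans (rank-suc-∈ a∈w) (trans (cong suc (rank-cong w w′ a (to ∘ ℕ.m<n⇒m<1+n) (from ∘ ℕ.m<n⇒m<1+n)))
                    (sym (rank-suc-∈ (to ℕ.≤-refl a∈w))))
  ... | no a∉w  = trans (rank-suc-∉ a∉w) (trans (rank-cong w w′ a (to ∘ ℕ.m<n⇒m<1+n) (from ∘ ℕ.m<n⇒m<1+n))
                    (sym (rank-suc-∉ (a∉w ∘ from ℕ.≤-refl))))

  rank-max : ∀ w b → ¬ w ≡ [] → All (_< b) w → ∃ λ m → m ∈ w × rank w b ≡ suc (rank w m)
  rank-max []      b        w≢[] _          = ⊥-elim (w≢[] refl)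
  rank-max (_ ∷ _) zero     _    (() ∷ _)
  rank-max w       (suc b)  w≢[] w<1+b with b ∈? w
  ... | yes b∈w = b , b∈w , rank-suc-∈ b∈w
  ... | no  b∉w =
    let m , m∈w , eq = rank-max w b w≢[] (All.tabulate (λ {y} y∈w → below y y∈w)) in
    m , m∈w , trans (rank-suc-∉ b∉w) eq
    where
    below : ∀ y → y ∈ w → y < b
    below y y∈w with ℕ.m≤n⇒m<n∨m≡n (ℕ.≤-pred (All.lookup w<1+b y∈w))
    ... | inj₁ y<b  = y<b
    ... | inj₂ refl = ⊥-elim (b∉w y∈w)

  std-snoc : ∀ f c → All (_< c) f → std (f ++ [ c ]) ≡ std f ++ [ suc (rank f c) ]
  std-snoc f c f<c = begin
    map (suc ∘ rank (f ++ [ c ])) (f ++ [ c ])                        ≡⟨ List.map-++ (suc ∘ rank (f ++ [ c ])) f [ c ] ⟩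
    map (suc ∘ rank (f ++ [ c ])) f ++ [ suc (rank (f ++ [ c ]) c) ]  ≡⟨ cong₂ (λ l y → l ++ [ y ])
                                                                          (List.map-cong-local (All.map (λ x<c → cong suc (same (ℕ.<⇒≤ x<c))) f<c))
                                                                          (cong suc (same ℕ.≤-refl)) ⟩
    std f ++ [ suc (rank f c) ]                                       ∎
    where
    same : ∀ {x} → x ≤ c → rank (f ++ [ c ]) x ≡ rank f x
    same {x} x≤c = rank-cong (f ++ [ c ]) f x
      (λ y<x y∈ → [ (λ y∈f → y∈f) , (λ { (here refl) → ⊥-elim (ℕ.<-irrefl refl (ℕ.<-≤-trans y<x x≤c)) }) ]′ (∈-++⁻ f y∈))
      (λ _ → ∈-++⁺ˡ)

  module Pattern {τ : Word} {r : ℕ} (τ-pattern : IsPatternMax τ r) where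

    private
      2≤r : 2 ≤ r
      2≤r = proj₁ τ-pattern
      τ-bounds : All (λ a → 1 ≤ a × a < r) τ
      τ-bounds = proj₁ (proj₂ τ-pattern)
      τ-onto : ∀ j → 1 ≤ j → j < r → j ∈ τ
      τ-onto = proj₂ (proj₂ τ-pattern)

    1+[r∸1]≡r : suc (r ∸ 1) ≡ r
    1+[r∸1]≡r = ℕ.m+[n∸m]≡n (ℕ.≤-trans (s≤s z≤n) 2≤r)

    0∉τ : 0 ∉ τ
    0∉τ 0∈τ with All.lookup τ-bounds 0∈τ
    ... | () , _

    τ<r : All (_< r) τ
    τ<r = All.map proj₂ τ-bounds

    rank-pattern : ∀ b → b ≤ r → rank τ b ≡ b ∸ 1
    rank-pattern zero          _     = refl
    rank-pattern (suc zero)    _     = rank-suc-∉ 0∉τ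
    rank-pattern (suc (suc b)) 2+b≤r = trans (rank-suc-∈ (τ-onto (suc b) (s≤s z≤n) 2+b≤r))
      (cong suc (rank-pattern (suc b) (ℕ.<⇒≤ 2+b≤r)))

    std-pattern : std τ ≡ τ
    std-pattern = List.map-id-local (All.map (λ { {suc x} (_ , 1+x<r) → cong suc (rank-pattern (suc x) (ℕ.<⇒≤ 1+x<r)) }) τ-bounds)

    std-pattern-snoc : std (τ ++ [ r ]) ≡ τ ++ [ r ]
    std-pattern-snoc = trans (std-snoc τ r τ<r)
      (cong₂ (λ l y → l ++ [ y ]) std-pattern (trans (cong suc (rank-pattern r ℕ.≤-refl)) 1+[r∸1]≡r))

    -- A copy of τ below c uses r - 1 distinct letters, all smaller than c.
    rank-above-copy : ∀ f c → All (_< c) f → std f ≡ τ → suc (rank f c) ≡ r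
    rank-above-copy f c f<c std-f≡τ = ℕ.≤-antisym upper lower
      where
      f≢[] : ¬ f ≡ []
      f≢[] refl with subst (1 ∈_) (sym std-f≡τ) (τ-onto 1 ℕ.≤-refl 2≤r)
      ... | ()
      upper : suc (rank f c) ≤ r
      upper with rank-max f c f≢[] f<c
      ... | m , m∈f , eq = subst (λ z → suc z ≤ r) (sym eq)
            (All.lookup τ<r (subst (suc (rank f m) ∈_) std-f≡τ (∈-map⁺ (suc ∘ rank f) m∈f)))
      r∸1∈std-f : r ∸ 1 ∈ std f
      r∸1∈std-f = subst (r ∸ 1 ∈_) (sym std-f≡τ)
        (τ-onto (r ∸ 1) (ℕ.≤-pred (subst (2 ≤_) (sym 1+[r∸1]≡r) 2≤r)) (subst (r ∸ 1 <_) 1+[r∸1]≡r ℕ.≤-refl))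
      lower : r ≤ suc (rank f c)
      lower with ∈-map⁻ (suc ∘ rank f) r∸1∈std-f
      ... | x , x∈f , eq = subst (_≤ suc (rank f c)) 1+[r∸1]≡r
            (s≤s (subst (_≤ rank f c) (sym eq) (rank-< f x∈f (All.lookup f<c x∈f))))

    orderIso-pattern-snoc : ∀ f c → T (orderIso (f ++ [ c ]) (τ ++ [ r ])) ⇔ (All (_< c) f × std f ≡ τ)
    orderIso-pattern-snoc f c = mk⇔ to from
      where
      from : All (_< c) f × std f ≡ τ → T (orderIso (f ++ [ c ]) (τ ++ [ r ]))
      from (f<c , std-f≡τ) = fromWitness (begin
        std (f ++ [ c ])              ≡⟨ std-snoc f c f<c ⟩
        std f ++ [ suc (rank f c) ]   ≡⟨ cong₂ (λ l y → l ++ [ y ]) std-f≡τ (rank-above-copy f c f<c std-f≡τ) ⟩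
        τ ++ [ r ]                    ≡⟨ std-pattern-snoc ⟨
        std (τ ++ [ r ])              ∎)
      to : T (orderIso (f ++ [ c ]) (τ ++ [ r ])) → All (_< c) f × std f ≡ τ
      to iso = f<c , proj₁ (List.∷ʳ-injective (std f) τ (trans (sym (std-snoc f c f<c)) std-f+c≡))
        where
        g : ℕ → ℕ
        g = suc ∘ rank (f ++ [ c ])
        std-f+c≡ : std (f ++ [ c ]) ≡ τ ++ [ r ]
        std-f+c≡ = trans (toWitness iso) std-pattern-snoc
        split : map g f ≡ τ × g c ≡ r
        split = List.∷ʳ-injective (map g f) τ (trans (sym (List.map-++ g f [ c ])) std-f+c≡)
        -- g is monotone and g c = r exceeds every letter of τ = map g f.
        f<c : All (_< c) f
        f<c = All.tabulate λ {x} x∈f →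
          let gx<r = All.lookup τ<r (subst (g x ∈_) (proj₁ split) (∈-map⁺ g x∈f))
          in ℕ.≰⇒> (λ c≤x → ℕ.<-irrefl refl (ℕ.<-≤-trans (subst (g x <_) (sym (proj₂ split)) gx<r)
                                                            (s≤s (rank-mono (f ++ [ c ]) c≤x))))

module PatternOccurrences where

  open Standardisation
  open import Data.Nat as ℕ using (zero; _<_; s≤s; z≤n; _+_)
  open import Data.List using (List; []; _∷_; upTo; _++_; [_]; length; take; drop)
  import Data.List.Properties as List
  open import Data.List.Membership.Propositional using (_∈_; _∉_)
  open import Data.List.Relation.Unary.All as All using (All)
  import Data.List.Relation.Unary.All.Properties as All
  import Data.List.Relation.Unary.Any.Properties as Any
  open import Data.List.Relation.Unary.Any using (here; there)
  open import Data.Bool using (true; false; T; not; _∧_)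
  open import Data.Bool.Properties using (T-∧)
  open import Data.Product using (_×_; _,_; proj₁; proj₂; Σ-syntax)
  open import Data.Sum as Sum using (_⊎_; inj₁; inj₂)
  open import Data.Empty using (⊥-elim)
  open import Function using (_∘_; id; _⇔_; mk⇔; Equivalence)
  open import Relation.Nullary using (¬_; yes; no)
  open import Relation.Binary.PropositionalEquality hiding ([_])
  open import Relation.Nullary.Decidable using (toWitness; fromWitness)

  Over : ℕ → Word → Set
  Over k = All (λ a → 1 ≤ a × a ≤ k)

  take-++ˡ : ∀ m (u ys : Word) → m ≤ length u → take m (u ++ ys) ≡ take m u
  take-++ˡ zero    u       ys _         = refl
  take-++ˡ (suc m) (x ∷ u) ys (s≤s m≤u) = cong (x ∷_) (take-++ˡ m u ys m≤u)

  drop-++ˡ : ∀ p (u ys : Word) → p ≤ length u → drop p (u ++ ys) ≡ drop p u ++ ys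
  drop-++ˡ zero    u       ys _         = refl
  drop-++ˡ (suc p) (x ∷ u) ys (s≤s p≤u) = drop-++ˡ p u ys p≤u

  drop-++ʳ : ∀ (u ys : Word) j → drop (length u + j) (u ++ ys) ≡ drop j ys
  drop-++ʳ []      ys j = refl
  drop-++ʳ (x ∷ u) ys j = drop-++ʳ u ys j

  factor-++ˡ : ∀ (u ys : Word) p m → p + m ≤ length u → factor (u ++ ys) p m ≡ factor u p m
  factor-++ˡ u ys p m p+m≤u = trans (cong (take m) (drop-++ˡ p u ys (ℕ.≤-trans (ℕ.m≤m+n p m) p+m≤u)))
    (take-++ˡ m (drop p u) ys (subst (m ≤_) (sym (List.length-drop p u))
      (ℕ.≤-trans (ℕ.≤-reflexive (sym (ℕ.m+n∸m≡n p m))) (ℕ.∸-monoˡ-≤ p p+m≤u))))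

  factor-++ʳ : ∀ (u ys : Word) j m → factor (u ++ ys) (length u + j) m ≡ factor ys j m
  factor-++ʳ u ys j m = cong (take m) (drop-++ʳ u ys j)

  at-++ʳ : ∀ (u ys : Word) j → at (u ++ ys) (length u + j) ≡ at ys j
  at-++ʳ []      ys j = refl
  at-++ʳ (x ∷ u) ys j = at-++ʳ u ys j

  at-middle : ∀ (u : Word) x ys → at (u ++ x ∷ ys) (length u) ≡ x
  at-middle []      x ys = refl
  at-middle (y ∷ u) x ys = at-middle u x ys

  at-∈ : ∀ w i → i < length w → at w i ∈ w
  at-∈ (x ∷ w) zero    _         = here refl
  at-∈ (x ∷ w) (suc i) (s≤s i<w) = there (at-∈ w i i<w)

  at-∈-factor : ∀ w p m i → p ≤ i → i < p + m → i < length w → at w i ∈ factor w p m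
  at-∈-factor (x ∷ w) zero    (suc m) zero    _         _             _         = here refl
  at-∈-factor (x ∷ w) zero    (suc m) (suc i) _         (s≤s i<m)     (s≤s i<w) = there (at-∈-factor w 0 m i z≤n i<m i<w)
  at-∈-factor (x ∷ w) (suc p) m       (suc i) (s≤s p≤i) (s≤s i<p+m)   (s≤s i<w) = at-∈-factor w p m i p≤i i<p+m i<w

  <⇒∃+suc : ∀ {a b} → a < b → Σ[ o ∈ ℕ ] a + suc o ≡ b
  <⇒∃+suc {a} a<b with ℕ.m≤n⇒∃[o]m+o≡n a<b
  ... | o , eq = o , trans (ℕ.+-suc a o) eq

  length-middle : ∀ (u : Word) x v → length (u ++ x ∷ v) ≡ length u + suc (length v)
  length-middle u x v = List.length-++ u

  not-≡-∧ : ∀ {x y z} → (T x → T y ⊎ T z) → (T y ⊎ T z → T x) → not x ≡ not y ∧ not z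
  not-≡-∧ {true}  {true}           _  _    = refl
  not-≡-∧ {true}  {false} {true}   _  _    = refl
  not-≡-∧ {true}  {false} {false}  to _    with to _
  ... | inj₁ ()
  ... | inj₂ ()
  not-≡-∧ {false} {true}           _  from = ⊥-elim (from (inj₁ _))
  not-≡-∧ {false} {false} {true}   _  from = ⊥-elim (from (inj₂ _))
  not-≡-∧ {false} {false} {false}  _  _    = refl

  T-not : ∀ {x} → ¬ T x → T (not x)
  T-not {true}  ¬x = ¬x _
  T-not {false} _  = _

  module Occurrences (τ : Word) (r : ℕ) where

    private
      m : ℕ
      m = length τ

    SubwordOccurrence : Word → Set
    SubwordOccurrence w = Σ[ p ∈ ℕ ] p + m ≤ length w × T (orderIso (factor w p m) τ)

    VincularOccurrence : Word → Set
    VincularOccurrence w = Σ[ p ∈ ℕ ] Σ[ q ∈ ℕ ] p + m ≤ q × q < length w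
                             × T (orderIso (factor w p m ++ [ at w q ]) (τ ++ [ r ]))

    containsSub⇔ : ∀ w → T (containsSub τ w) ⇔ SubwordOccurrence w
    containsSub⇔ w = mk⇔ to from
      where
      to : T (containsSub τ w) → SubwordOccurrence w
      to c with Any.applyUpTo⁻ id (Any.any⁻ _ (upTo (suc (length w))) c)
      ... | p , _ , hit = let fits , iso = Equivalence.to T-∧ hit in p , ℕ.≤ᵇ⇒≤ _ _ fits , iso
      from : SubwordOccurrence w → T (containsSub τ w)
      from (p , fits , iso) = Any.any⁺ _ (Any.applyUpTo⁺ id (Equivalence.from T-∧ (ℕ.≤⇒≤ᵇ fits , iso))
                                                         (s≤s (ℕ.≤-trans (ℕ.m≤m+n p m) fits)))

    containsVinc⇔ : ∀ w → T (containsVinc τ r w) ⇔ VincularOccurrence w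
    containsVinc⇔ w = mk⇔ to from
      where
      to : T (containsVinc τ r w) → VincularOccurrence w
      to c with Any.applyUpTo⁻ id (Any.any⁻ _ (upTo (length w)) c)
      ... | p , _ , hitₚ with Any.applyUpTo⁻ id (Any.any⁻ _ (upTo (length w)) hitₚ)
      ... | q , _ , hit =
        let gap , rest = Equivalence.to T-∧ hit
            q<w , iso = Equivalence.to T-∧ rest
        in p , q , ℕ.≤ᵇ⇒≤ _ _ gap , ℕ.≤ᵇ⇒≤ _ _ q<w , iso
      from : VincularOccurrence w → T (containsVinc τ r w)
      from (p , q , gap , q<w , iso) =
        Any.any⁺ _ (Any.applyUpTo⁺ id
          (Any.any⁺ _ (Any.applyUpTo⁺ id
            (Equivalence.from T-∧ (ℕ.≤⇒≤ᵇ gap , Equivalence.from T-∧ (ℕ.≤⇒≤ᵇ q<w , iso))) q<w))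
          (ℕ.≤-<-trans (ℕ.≤-trans (ℕ.m≤m+n p m) gap) q<w))

  module Splitting {τ : Word} {r : ℕ} (τ-pattern : IsPatternMax τ r) where

    open Pattern τ-pattern
    open Occurrences τ r
    private
      m : ℕ
      m = length τ

    -- No occurrence straddles the letter k+1: inside the copy of τ it would lie below the final letter, which is at most k+1.
    vincular-split : ∀ k u v → Over (suc k) v → VincularOccurrence (u ++ suc k ∷ v) →
                     SubwordOccurrence u ⊎ VincularOccurrence v
    vincular-split k u v v-over (p , q , gap , q<w , iso)
      with Equivalence.to (orderIso-pattern-snoc (factor (u ++ suc k ∷ v) p m) (at (u ++ suc k ∷ v) q)) iso
    ... | f<c , std-f≡τ with p + m ℕ.≤? length u
    ...   | yes fits = inj₁ (p , fits , fromWitness (begin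
              std (factor u p m)                 ≡⟨ cong std (factor-++ˡ u (suc k ∷ v) p m fits) ⟨
              std (factor (u ++ suc k ∷ v) p m)  ≡⟨ std-f≡τ ⟩
              τ                                  ≡⟨ std-pattern ⟨
              std τ                              ∎))
      where open ≡-Reasoning
    ...   | no overlaps with <⇒∃+suc (ℕ.<-≤-trans (ℕ.≰⇒> overlaps) gap)
    ...     | q′ , refl with p ℕ.≤? length u
    ...       | yes p≤u = ⊥-elim (ℕ.<-irrefl refl (ℕ.<-≤-trans k+1<c c≤k+1))
      where
      w : Word
      w = u ++ suc k ∷ v
      k+1<c : suc k < at w (length u + suc q′)
      k+1<c = subst (_< at w (length u + suc q′)) (at-middle u (suc k) v)
        (All.lookup f<c (at-∈-factor w p m (length u) p≤u (ℕ.≰⇒> overlaps)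
          (subst (length u <_) (sym (length-middle u (suc k) v)) (ℕ.m<m+n (length u) (s≤s z≤n)))))
      c≤k+1 : at w (length u + suc q′) ≤ suc k
      c≤k+1 = subst (_≤ suc k) (sym (at-++ʳ u (suc k ∷ v) (suc q′)))
        (proj₂ (All.lookup v-over (at-∈ v q′ (ℕ.≤-pred (ℕ.+-cancelˡ-< (length u) (suc q′) _
          (subst (length u + suc q′ <_) (length-middle u (suc k) v) q<w))))))
    ...       | no u<p with <⇒∃+suc (ℕ.≰⇒> u<p)
    ...         | p′ , refl = inj₂ (p′ , q′ , gap′ , q′<v , iso′)
      where
      q′<v : q′ < length v
      q′<v = ℕ.≤-pred (ℕ.+-cancelˡ-< (length u) (suc q′) _ (subst (length u + suc q′ <_) (length-middle u (suc k) v) q<w))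
      gap′ : p′ + m ≤ q′
      gap′ = ℕ.≤-pred (ℕ.+-cancelˡ-≤ (length u) (suc (p′ + m)) (suc q′)
        (subst (_≤ length u + suc q′) (ℕ.+-assoc (length u) (suc p′) m) gap))
      iso′ : T (orderIso (factor v p′ m ++ [ at v q′ ]) (τ ++ [ r ]))
      iso′ = subst₂ (λ f c → T (orderIso (f ++ [ c ]) (τ ++ [ r ])))
               (factor-++ʳ u (suc k ∷ v) (suc p′) m) (at-++ʳ u (suc k ∷ v) (suc q′)) iso

    vincular-join : ∀ k u v → Over k u → SubwordOccurrence u ⊎ VincularOccurrence v → VincularOccurrence (u ++ suc k ∷ v)
    vincular-join k u v u-over (inj₁ (p , fits , iso)) =
      p , length u , fits , u<w , subst₂ (λ f c → T (orderIso (f ++ [ c ]) (τ ++ [ r ])))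
        (sym (factor-++ˡ u (suc k ∷ v) p m fits)) (sym (at-middle u (suc k) v))
        (Equivalence.from (orderIso-pattern-snoc (factor u p m) (suc k)) (f<k+1 , trans (toWitness iso) std-pattern))
      where
      u<w : length u < length (u ++ suc k ∷ v)
      u<w = subst (length u <_) (sym (length-middle u (suc k) v)) (ℕ.m<m+n (length u) (s≤s z≤n))
      f<k+1 : All (_< suc k) (factor u p m)
      f<k+1 = All.take⁺ m (All.drop⁺ p (All.map (s≤s ∘ proj₂) u-over))
    vincular-join k u v u-over (inj₂ (p , q , gap , q<v , iso)) =
      length u + suc p , length u + suc q , gap′ , q′<w , subst₂ (λ f c → T (orderIso (f ++ [ c ]) (τ ++ [ r ])))
        (sym (factor-++ʳ u (suc k ∷ v) (suc p) m)) (sym (at-++ʳ u (suc k ∷ v) (suc q))) iso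
      where
      gap′ : length u + suc p + m ≤ length u + suc q
      gap′ = subst (_≤ length u + suc q) (sym (ℕ.+-assoc (length u) (suc p) m)) (ℕ.+-monoʳ-≤ (length u) (s≤s gap))
      q′<w : length u + suc q < length (u ++ suc k ∷ v)
      q′<w = subst (length u + suc q <_) (sym (length-middle u (suc k) v)) (ℕ.+-monoʳ-< (length u) (s≤s q<v))

    avoids-split : ∀ k u v → Over k u → Over (suc k) v →
                   not (containsVinc τ r (u ++ suc k ∷ v)) ≡ not (containsSub τ u) ∧ not (containsVinc τ r v)
    avoids-split k u v u-over v-over = not-≡-∧
      (Sum.map (from (containsSub⇔ u)) (from (containsVinc⇔ v)) ∘ vincular-split k u v v-over
        ∘ to (containsVinc⇔ (u ++ suc k ∷ v)))
      (from (containsVinc⇔ (u ++ suc k ∷ v)) ∘ vincular-join k u v u-over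
        ∘ Sum.map (to (containsSub⇔ u)) (to (containsVinc⇔ v)))
      where open Equivalence

    -- The final letter of an occurrence exceeds the r - 1 distinct letters of a copy of τ, so it is at least r.
    avoids-over-small : ∀ w → Over (r ∸ 1) w → T (not (containsVinc τ r w))
    avoids-over-small w w-over = T-not (no-occurrence ∘ Equivalence.to (containsVinc⇔ w))
      where
      no-occurrence : ¬ VincularOccurrence w
      no-occurrence (p , q , _ , q<w , iso) =
        ℕ.<-irrefl refl (ℕ.≤-trans (ℕ.≤-reflexive 1+[r∸1]≡r) (ℕ.≤-trans (r≤ c (proj₁ c-bounds) r≡) (proj₂ c-bounds)))
        where
        f : Word
        f = factor w p m
        c : ℕ
        c = at w q
        c-bounds : 1 ≤ c × c ≤ r ∸ 1
        c-bounds = All.lookup w-over (at-∈ w q q<w)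
        0∉f : 0 ∉ f
        0∉f 0∈f with All.lookup (All.take⁺ m (All.drop⁺ p w-over)) 0∈f
        ... | () , _
        copy : All (_< c) f × std f ≡ τ
        copy = Equivalence.to (orderIso-pattern-snoc f c) iso
        r≡ : suc (rank f c) ≡ r
        r≡ = rank-above-copy f c (proj₁ copy) (proj₂ copy)
        r≤ : ∀ b → 1 ≤ b → suc (rank f b) ≡ r → r ≤ b
        r≤ (suc b) _ eq = subst (_≤ suc b) eq (s≤s (rank-positive-≤ f b 0∉f))

module Counting where

  open PatternOccurrences using (Over)
  open import Data.Nat as ℕ using (zero; s≤s; z≤n; _+_; _*_; _^_)
  open import Data.List using (List; []; _∷_; map; applyUpTo; _++_; filter; length; concatMap)
  import Data.List.Properties as List
  open import Data.List.Relation.Unary.All as All using (All; []; _∷_)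
  import Data.List.Relation.Unary.All.Properties as All
  open import Data.Bool using (Bool; true; false; T; T?; _∧_; if_then_else_)
  open import Data.Product using (_,_)
  open import Function using (_∘_)
  open import Relation.Binary.PropositionalEquality
  open import Algebra.Properties.CommutativeSemigroup ℕ.+-commutativeSemigroup using (xy∙z≈x∙zy)
  open ℕ-Sums

  count-++ : ∀ P (xs ys : List Word) → count P (xs ++ ys) ≡ count P xs + count P ys
  count-++ P xs ys = trans (cong length (List.filter-++ (T? ∘ P) xs ys)) (List.length-++ (filter (T? ∘ P) xs))

  count-map : ∀ P (g : Word → Word) ws → count P (map g ws) ≡ count (P ∘ g) ws
  count-map P g []       = refl
  count-map P g (w ∷ ws) with P (g w)
  ... | true  = cong suc (count-map P g ws)
  ... | false = count-map P g ws

  count-cong : ∀ {P Q} ws → All (λ w → P w ≡ Q w) ws → count P ws ≡ count Q ws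
  count-cong             []       []            = refl
  count-cong {P} {Q} (w ∷ ws) (P≡Q ∷ rest) with P w | Q w
  count-cong (w ∷ ws) (refl ∷ rest) | true  | true  = cong suc (count-cong ws rest)
  count-cong (w ∷ ws) (refl ∷ rest) | false | false = count-cong ws rest

  count-all : ∀ P ws → All (T ∘ P) ws → count P ws ≡ length ws
  count-all P ws all = cong length (List.filter-all (T? ∘ P) all)

  count-∧ˡ : ∀ b Q ws → count (λ w → b ∧ Q w) ws ≡ (if b then count Q ws else 0)
  count-∧ˡ true  Q ws       = refl
  count-∧ˡ false Q []       = refl
  count-∧ˡ false Q (w ∷ ws) = count-∧ˡ false Q ws

  count-by-first-letter : ∀ P n k → count P (words (suc n) k) ≡ ∑< (λ i → count (P ∘ (suc i ∷_)) (words n k)) k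
  count-by-first-letter P n k = over suc k
    where
    over : ∀ g j → count P (concatMap (λ a → map (a ∷_) (words n k)) (applyUpTo g j))
                 ≡ ∑< (λ i → count (P ∘ (g i ∷_)) (words n k)) j
    over g zero    = refl
    over g (suc j) = trans (count-++ P (map (g 0 ∷_) (words n k)) _)
      (cong₂ _+_ (count-map P (g 0 ∷_) (words n k)) (over (g ∘ suc) j))

  words-over : ∀ n k → All (Over k) (words n k)
  words-over zero    k = [] ∷ []
  words-over (suc n) k = All.concat⁺ (All.map⁺ (All.applyUpTo⁺₁ suc k
    (λ i<k → All.map⁺ (All.map ((s≤s z≤n , i<k) ∷_) (words-over n k)))))

  length-words : ∀ n k → length (words n k) ≡ k ^ n
  length-words zero    k = refl
  length-words (suc n) k = begin
    length (words (suc n) k)                      ≡⟨ count-true (words (suc n) k) ⟨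
    count (λ _ → true) (words (suc n) k)          ≡⟨ count-by-first-letter (λ _ → true) n k ⟩
    ∑< (λ _ → count (λ _ → true) (words n k)) k   ≡⟨ cong (λ c → ∑< (λ _ → c) k) (trans (count-true (words n k)) (length-words n k)) ⟩
    ∑< (λ _ → k ^ n) k                            ≡⟨ ∑<-const (k ^ n) k ⟩
    k * k ^ n                                     ∎
    where
    open ≡-Reasoning
    count-true : ∀ ws → count (λ _ → true) ws ≡ length ws
    count-true ws = count-all (λ _ → true) ws (All.universal _ ws)
    ∑<-const : ∀ x j → ∑< (λ _ → x) j ≡ j * x
    ∑<-const x zero    = refl
    ∑<-const x (suc j) = cong (_+_ x) (∑<-const x j)

  -- A word over [k+1] is either over [k] or splits as u (k+1) v at its first letter k+1, with u over [k].
  count-split : ∀ k N (P A B : Word → Bool) →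
    (∀ u v → Over k u → Over (suc k) v → P (u ++ suc k ∷ v) ≡ A u ∧ B v) →
    count P (words N (suc k)) ≡ count P (words N k) + ∑< (λ i → count A (words i k) * count B (words (N ∸ suc i) (suc k))) N
  count-split k zero    P A B split = sym (ℕ.+-identityʳ _)
  count-split k (suc N) P A B split = begin
    count P (words (suc N) (suc k))
      ≡⟨ count-by-first-letter P N (suc k) ⟩
    ∑< (λ i → count (P ∘ (suc i ∷_)) (words N (suc k))) (suc k)
      ≡⟨ ∑<-suc (λ i → count (P ∘ (suc i ∷_)) (words N (suc k))) k ⟩
    ∑< (λ i → count (P ∘ (suc i ∷_)) (words N (suc k))) k + count (P ∘ (suc k ∷_)) (words N (suc k))
      ≡⟨ cong₂ _+_ smaller-first-letter largest-first-letter ⟩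
    count P (words (suc N) k) + ∑< (λ i → count A (words (suc i) k) * cB (N ∸ suc i)) N + count A (words 0 k) * cB N
      ≡⟨ xy∙z≈x∙zy (count P (words (suc N) k)) _ _ ⟩
    count P (words (suc N) k) + ∑< (λ i → count A (words i k) * cB (suc N ∸ suc i)) (suc N)
      ∎
    where
    open ≡-Reasoning
    cB : ℕ → ℕ
    cB j = count B (words j (suc k))
    smaller-first-letter : ∑< (λ i → count (P ∘ (suc i ∷_)) (words N (suc k))) k
                         ≡ count P (words (suc N) k) + ∑< (λ i → count A (words (suc i) k) * cB (N ∸ suc i)) N
    smaller-first-letter = begin
      ∑< (λ a → count (P ∘ (suc a ∷_)) (words N (suc k))) k
        ≡⟨ ∑<-cong k (λ a a<k → count-split k N (P ∘ (suc a ∷_)) (A ∘ (suc a ∷_)) B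
                                   (λ u v u-over v-over → split (suc a ∷ u) v ((s≤s z≤n , a<k) ∷ u-over) v-over)) ⟩
      ∑< (λ a → count (P ∘ (suc a ∷_)) (words N k) + ∑< (λ i → count (A ∘ (suc a ∷_)) (words i k) * cB (N ∸ suc i)) N) k
        ≡⟨ ∑<-+ _ _ k ⟩
      ∑< (λ a → count (P ∘ (suc a ∷_)) (words N k)) k + ∑< (λ a → ∑< (λ i → count (A ∘ (suc a ∷_)) (words i k) * cB (N ∸ suc i)) N) k
        ≡⟨ cong₂ _+_ (sym (count-by-first-letter P N k)) (∑<-comm _ N k) ⟩
      count P (words (suc N) k) + ∑< (λ i → ∑< (λ a → count (A ∘ (suc a ∷_)) (words i k) * cB (N ∸ suc i)) k) N
        ≡⟨ cong (_+_ (count P (words (suc N) k))) (∑<-cong N (λ i _ →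
             trans (∑<-*ʳ (cB (N ∸ suc i)) _ k) (cong (_* cB (N ∸ suc i)) (sym (count-by-first-letter A i k))))) ⟩
      count P (words (suc N) k) + ∑< (λ i → count A (words (suc i) k) * cB (N ∸ suc i)) N
        ∎
    largest-first-letter : count (P ∘ (suc k ∷_)) (words N (suc k)) ≡ count A (words 0 k) * cB N
    largest-first-letter with trans (count-cong (words N (suc k)) (All.map (split [] _ []) (words-over N (suc k))))
                                    (count-∧ˡ (A []) B (words N (suc k)))
    ... | eq with A []
    ...   | true  = trans eq (sym (ℕ.+-identityʳ (cB N)))
    ...   | false = eq

module AvoiderSeries {τ : Word} {r : ℕ} (τ-pattern : IsPatternMax τ r) where

  open import Data.Nat as ℕ using (zero)
  open import Data.Integer using (_+_)
  open import Data.Bool using (not)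
  open import Data.List.Relation.Unary.All as All using ()
  open import Function using (_∘_)
  open import Relation.Binary.PropositionalEquality
  open PowerSeries using (conv; ⊛≗conv)
  open PatternOccurrences
  open Counting
  open Splitting τ-pattern

  pos-∑< : ∀ h n → + ℕ-Sums.∑< h n ≡ ℤ-Sums.∑< (+_ ∘ h) n
  pos-∑< h zero    = refl
  pos-∑< h (suc n) = trans (ℤ.pos-+ (h 0) (ℕ-Sums.∑< (h ∘ suc) n)) (cong (_+_ (+ h 0)) (pos-∑< (h ∘ suc) n))

  WVinc-base : ∀ n → WVinc τ r (r ∸ 1) n ≡ + ((r ∸ 1) ℕ.^ n)
  WVinc-base n = cong +_ (trans
    (count-all (not ∘ containsVinc τ r) (words n (r ∸ 1)) (All.map (avoids-over-small _) (words-over n (r ∸ 1))))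
    (length-words n (r ∸ 1)))

  WVinc-recurrence : ∀ k n → WVinc τ r (suc k) n ≡ WVinc τ r k n + xMul (WSub τ k ⊛ WVinc τ r (suc k)) n
  WVinc-recurrence k zero    = refl
  WVinc-recurrence k (suc n) = begin
    + aVinc τ r (suc n) (suc k)
      ≡⟨ cong +_ (count-split k (suc n) (not ∘ containsVinc τ r) (not ∘ containsSub τ) (not ∘ containsVinc τ r)
                              (avoids-split k)) ⟩
    + (aVinc τ r (suc n) k ℕ.+ ℕ-Sums.∑< product (suc n))
      ≡⟨ ℤ.pos-+ (aVinc τ r (suc n) k) _ ⟩
    WVinc τ r k (suc n) + + ℕ-Sums.∑< product (suc n)
      ≡⟨ cong (_+_ (WVinc τ r k (suc n))) (trans (pos-∑< product (suc n))
           (ℤ-Sums.∑<-cong (suc n) (λ i _ → ℤ.pos-* (aSub τ i k) (aVinc τ r (n ∸ i) (suc k))))) ⟩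
    WVinc τ r k (suc n) + conv (WSub τ k) (WVinc τ r (suc k)) n
      ≡⟨ cong (_+_ (WVinc τ r k (suc n))) (⊛≗conv (WSub τ k) (WVinc τ r (suc k)) n) ⟨
    WVinc τ r k (suc n) + (WSub τ k ⊛ WVinc τ r (suc k)) n
      ∎
    where
    open ≡-Reasoning
    product : ℕ → ℕ
    product i = aSub τ i k ℕ.* aVinc τ r (n ∸ i) (suc k)

open PowerSeries

theorem4p1 : (τ : Word) (r : ℕ) → IsPatternMax τ r →
    (k : ℕ) → r ∸ 1 ≤ k →
    (n : ℕ) →
      ((WVinc τ r k ⊛ (one ⊖ xMul (constPS (+ (r ∸ 1)))))
        ⊛ prodRange (r ∸ 1) k (λ j → one ⊖ xMul (WSub τ j))) n
      ≡ one n
theorem4p1 τ r τ-pattern k r∸1≤k = begin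
  (V k ⊛ L) ⊛ P     ≈⟨ xy∙z≈y∙xz (V k) L P ⟩
  L ⊛ (V k ⊛ P)     ≈⟨ ∙-congˡ {L} (prodRange-telescope V F factor-step r∸1≤k) ⟩
  L ⊛ V (r ∸ 1)     ≈⟨ one⊖xMul-const-⊛-powers (r ∸ 1) (V (r ∸ 1)) WVinc-base ⟩
  one               ∎
  where
  open AvoiderSeries τ-pattern
  open CommutativeMonoid ⊛-commutativeMonoid using (setoid; ∙-congˡ; commutativeSemigroup)
  open import Algebra.Properties.CommutativeSemigroup commutativeSemigroup using (xy∙z≈y∙xz)
  open import Relation.Binary.Reasoning.Setoid setoid
  V F : ℕ → PS
  V = WVinc τ r
  F j = one ⊖ xMul (WSub τ j)
  L P : PS
  L = one ⊖ xMul (constPS (+ (r ∸ 1)))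
  P = prodRange (r ∸ 1) k F
  factor-step : ∀ j → F j ⊛ V (suc j) ≗ V j
  factor-step j = one⊖xMul-⊛-recurrence (WSub τ j) (V (suc j)) (V j) (WVinc-recurrence j)
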